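{- Assuming $\mathsf{CSB}^*$, for any $k\in\{1,2,3,4\}$: $\mathsf{WF}^s_{sk} \rightarrow \mathsf{WF}^s_{ik} \rightarrow \mathsf{WF}^s_{bk}$ (so, together with the reverse implications valid in $\mathsf{ZF}$, $\mathsf{WF}^s_{sk}$, $\mathsf{WF}^s_{ik}$, $\mathsf{WF}^s_{bk}$ are equivalent).
   Context: Work in $\mathsf{ZF}+\mathsf{CSB}^*$, where $\mathsf{CSB}^*$ states: if $|X|\leq^*|Y|$ and $|Y|\leq^*|X|$ then $|X|=|Y|$. For sets: $|X|\leq|Y|$ means $X$ injects into $Y$; $|X|\leq^*|Y|$ means $X=\emptyset$ or $Y$ surjects onto $X$; $|X|=|Y|$ means a bijection exists. The principles $\mathsf{WF}^s_{yk}$ have hypothesis comparison $\leq^*$ and conclusion comparison $\leq$ ($y=i$), $\leq^*$ ($y=s$), or $=$ ($y=b$): $\mathsf{WF}^s_{y1}$: given a non-empty set $S$ of cardinals, there is $\kappa\in S$ such that for any $\lambda\in S$ with $\lambda\leq^*\kappa$, $\kappa$ and $\lambda$ satisfy the conclusion relation. $\mathsf{WF}^s_{y2}$: if $\kappa_0\geq^*\kappa_1\geq^*\cdots$ are cardinals, then for some $n$, $\kappa_n$ and $\kappa_{n+1}$ satisfy the conclusion relation. $\mathsf{WF}^s_{y3}$: same with sets $(A_n)$ with $|A_0|\geq^*|A_1|\geq^*\cdots$. $\mathsf{WF}^s_{y4}$: same with sets $(A_n)$ together with given surjections $f_n:A_n\to A_{n+1}$. -}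

module Defs where

open import Level using (Level; _⊔_; suc; Setω)
open import Data.Nat using (ℕ) renaming (suc to sucℕ)
open import Data.Fin using (Fin) renaming (zero to fz; suc to fs)
open import Data.Empty using (⊥)
open import Data.Sum using (_⊎_)
open import Data.Product using (Σ; _×_)
open import Relation.Nullary using (¬_; Dec)
open import Relation.Binary.PropositionalEquality using (_≡_)

-- Sets of ZF are modelled by types in a universe Set ℓ; ZF's classical
-- logic is supplied by an explicit excluded-middle hypothesis for
-- propositions (types with at most one element).  Existence statements
-- are stated classically (double negation), so that no choice principle
-- is built into the encoding.

isProp : ∀ {a} → Set a → Set a
isProp P = (x y : P) → x ≡ y

LEM : Setω
LEM = ∀ {a} (P : Set a) → isProp P → Dec P

∃c : ∀ {a b} (A : Set a) → (A → Set b) → Set (a ⊔ b)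
∃c A P = ¬ ¬ (Σ A P)

Injective : ∀ {a b} {X : Set a} {Y : Set b} → (X → Y) → Set (a ⊔ b)
Injective f = ∀ x y → f x ≡ f y → x ≡ y

Surjective : ∀ {a b} {X : Set a} {Y : Set b} → (X → Y) → Set (a ⊔ b)
Surjective {X = X} f = ∀ y → ∃c X (λ x → f x ≡ y)

Bijective : ∀ {a b} {X : Set a} {Y : Set b} → (X → Y) → Set (a ⊔ b)
Bijective f = Injective f × Surjective f

_≤c_ : ∀ {ℓ} → Set ℓ → Set ℓ → Set ℓ
X ≤c Y = ∃c (X → Y) Injective

_≤*_ : ∀ {ℓ} → Set ℓ → Set ℓ → Set ℓ
X ≤* Y = ¬ ¬ ((¬ X) ⊎ Σ (Y → X) Surjective)

_≈c_ : ∀ {ℓ} → Set ℓ → Set ℓ → Set ℓ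
X ≈c Y = ∃c (X → Y) Bijective

CSB* : (ℓ : Level) → Set (suc ℓ)
CSB* ℓ = (X Y : Set ℓ) → X ≤* Y → Y ≤* X → X ≈c Y

data Rel : Set where
  i s b : Rel

conclRel : ∀ {ℓ} → Rel → Set ℓ → Set ℓ → Set ℓ
conclRel i X Y = X ≤c Y
conclRel s X Y = X ≤* Y
conclRel b X Y = X ≈c Y

record Card (ℓ : Level) : Set (suc ℓ) where
  field
    mem      : Set ℓ → Set ℓ
    nonempty : ∃c (Set ℓ) mem
    closed   : (X Y : Set ℓ) → X ≈c Y → mem X → mem Y
    same     : (X Y : Set ℓ) → mem X → mem Y → X ≈c Y
open Card public

-- Lift a relation on sets to cardinals (via arbitrary representatives;
-- all relations involved are invariant under bijection).
liftC : ∀ {ℓ} → (Set ℓ → Set ℓ → Set ℓ) → Card ℓ → Card ℓ → Set (suc ℓ)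
liftC R κ λ' = (X Y : Set _) → mem κ X → mem λ' Y → R X Y

_≤*C_ : ∀ {ℓ} → Card ℓ → Card ℓ → Set (suc ℓ)
_≤*C_ = liftC _≤*_

conclRelC : ∀ {ℓ} → Rel → Card ℓ → Card ℓ → Set (suc ℓ)
conclRelC y = liftC (conclRel y)

WF1 : (ℓ : Level) → Rel → Set (suc ℓ)
WF1 ℓ y = (I : Set ℓ) (S : I → Card ℓ) → ¬ ¬ I →
  ∃c I (λ k → (j : I) → S j ≤*C S k → conclRelC y (S k) (S j))

WF2 : (ℓ : Level) → Rel → Set (suc ℓ)
WF2 ℓ y = (κ : ℕ → Card ℓ) → ((n : ℕ) → κ (sucℕ n) ≤*C κ n) →
  ∃c ℕ (λ n → conclRelC y (κ n) (κ (sucℕ n)))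

WF3 : (ℓ : Level) → Rel → Set (suc ℓ)
WF3 ℓ y = (A : ℕ → Set ℓ) → ((n : ℕ) → A (sucℕ n) ≤* A n) →
  ∃c ℕ (λ n → conclRel y (A n) (A (sucℕ n)))

WF4 : (ℓ : Level) → Rel → Set (suc ℓ)
WF4 ℓ y = (A : ℕ → Set ℓ) (f : (n : ℕ) → A n → A (sucℕ n)) →
  ((n : ℕ) → Surjective (f n)) →
  ∃c ℕ (λ n → conclRel y (A n) (A (sucℕ n)))

WF : (ℓ : Level) → Rel → Fin 4 → Set (suc ℓ)
WF ℓ y fz = WF1 ℓ y
WF ℓ y (fs fz) = WF2 ℓ y
WF ℓ y (fs (fs fz)) = WF3 ℓ y
WF ℓ y (fs (fs (fs fz))) = WF4 ℓ y

module Submission where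

-- Under CSB*, the hypothesis λ ≤* κ shared by all the principles upgrades the
-- conclusions κ ≤* λ and κ ≤ λ to κ = λ (the latter since an injection X → Y
-- yields, by excluded middle, a surjection Y → X).  Hence a WF principle with
-- conclusion ≤* gives the one with ≤, and the one with ≤ gives the one with =.

open import Defs
open import Level using (Level)
open import Data.Fin using (Fin) renaming (zero to fz; suc to fs)
open import Data.Nat using () renaming (suc to sucℕ)
open import Data.Product using (_×_; _,_; Σ; proj₁)
open import Data.Sum using (inj₁; inj₂)
open import Data.Empty using (⊥-elim)
open import Relation.Nullary using (yes; no)
open import Relation.Binary.PropositionalEquality using (_≡_; refl; sym; trans)
open import Axiom.UniquenessOfIdentityProofs.WithK using (uip)

∃c-map : ∀ {a b c} {A : Set a} {P : A → Set b} {Q : A → Set c} →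
         (∀ x → P x → Q x) → ∃c A P → ∃c A Q
∃c-map g h k = h λ { (x , p) → k (x , g x p) }

≈c⇒≤c : ∀ {ℓ} {X Y : Set ℓ} → X ≈c Y → X ≤c Y
≈c⇒≤c = ∃c-map (λ _ → proj₁)

fibre-isProp : ∀ {a b} {X : Set a} {Y : Set b} (f : X → Y) → Injective f →
               (y : Y) → isProp (Σ X (λ x → f x ≡ y))
fibre-isProp f inj y (x , p) (x′ , p′) with inj x x′ (trans p (sym p′))
... | refl with uip p p′
...   | refl = refl

module _ (lem : LEM) {a b} {X : Set a} {Y : Set b}
         (f : X → Y) (inj : Injective f) (x₀ : X) where

  retraction : Y → X
  retraction y with lem (Σ X (λ x → f x ≡ y)) (fibre-isProp f inj y)
  ... | yes (x , _) = x
  ... | no _        = x₀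

  retraction-inverseˡ : ∀ x → retraction (f x) ≡ x
  retraction-inverseˡ x with lem (Σ X (λ x′ → f x′ ≡ f x)) (fibre-isProp f inj (f x))
  ... | yes (x′ , e) = inj x′ x e
  ... | no ¬fibre    = ⊥-elim (¬fibre (x , refl))

  retraction-surjective : Surjective retraction
  retraction-surjective x k = k (f x , retraction-inverseˡ x)

≤c⇒≤* : LEM → ∀ {ℓ} {X Y : Set ℓ} → X ≤c Y → X ≤* Y
≤c⇒≤* lem X≤Y k = X≤Y λ { (f , inj) →
  k (inj₁ λ x₀ → k (inj₂ (retraction lem f inj x₀ , retraction-surjective lem f inj x₀))) }

ConclusionImplies : (ℓ : Level) → Rel → Rel → Set (Level.suc ℓ)
ConclusionImplies ℓ y y′ = (X Y : Set ℓ) → Y ≤* X → conclRel y X Y → conclRel y′ X Y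

WF-mono : ∀ {ℓ y y′} → ConclusionImplies ℓ y y′ → (k : Fin 4) → WF ℓ y k → WF ℓ y′ k
WF-mono weaken fz wf I S ne =
  ∃c-map (λ κ min j λ≤κ X Y mX mY → weaken X Y (λ≤κ Y X mY mX) (min j λ≤κ X Y mX mY))
         (wf I S ne)
WF-mono weaken (fs fz) wf κ dec =
  ∃c-map (λ n c X Y mX mY → weaken X Y (dec n Y X mY mX) (c X Y mX mY)) (wf κ dec)
WF-mono weaken (fs (fs fz)) wf A dec =
  ∃c-map (λ n → weaken (A n) (A (sucℕ n)) (dec n)) (wf A dec)
WF-mono weaken (fs (fs (fs fz))) wf A f surj =
  ∃c-map (λ n → weaken (A n) (A (sucℕ n)) (λ k → k (inj₂ (f n , surj n)))) (wf A f surj)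

proposition9p7 : LEM → (ℓ : Level) → CSB* ℓ → (k : Fin 4) →
    (WF ℓ s k → WF ℓ i k) × (WF ℓ i k → WF ℓ b k)
proposition9p7 lem ℓ csb k = WF-mono s⇒i k , WF-mono i⇒b k
  where
  s⇒i : ConclusionImplies ℓ s i
  s⇒i X Y Y≤*X X≤*Y = ≈c⇒≤c (csb X Y X≤*Y Y≤*X)

  i⇒b : ConclusionImplies ℓ i b
  i⇒b X Y Y≤*X X≤Y = csb X Y (≤c⇒≤* lem X≤Y) Y≤*X
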